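{- Let $T$ be a tree that is not a path, let $\ell$ be a leaf of $T$, let $P_\ell$ be the path branch of $T$ containing $\ell$, let $v$ be the neighbor of $P_\ell$, and let $X\subseteq V(T)$ be any set with $\ell\notin X$. Then \[ \mathcal{F}_{T,-X} = \mathcal{F}_{T,\ell,-X} + \mathcal{F}_{T-P_\ell,-(X\cup\{v\})}. \]
   Context: For a graph $H$ and vertex set $A$, $\mathcal{F}_{H,-A}$ is the number of minimal forts of $H$ that are disjoint from $A$ (only the vertices of $A$ lying in $H$ matter), and $\mathcal{F}_{T,\ell,-X}$ is the number of minimal forts of $T$ that contain $\ell$ and are disjoint from $X$. A fort of a graph is a nonempty set $F$ of vertices such that every vertex not in $F$ is adjacent to either zero or at least two vertices of $F$; it is minimal if no proper subset is a fort. For a leaf $\ell$ of a tree $T$, the path branch of $\ell$ is the maximal connected induced subgraph containing $\ell$ all of whose vertices have degree one or two in $T$; the neighbor of the path branch is the unique vertex not in the path branch adjacent to a vertex of the path branch. $T-P_\ell$ is the tree obtained by deleting the vertices of $P_\ell$. -}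

module Defs where

open import Data.Bool using (Bool; true; false)
open import Data.Nat using (ℕ; zero; suc; _+_; _≤_; _≤?_)
import Data.Nat as ℕ
open import Data.Fin using (Fin; toℕ)
open import Data.Fin.Properties using (all?)
open import Data.Fin.Subset
  using (Subset; inside; outside; _∈_; _∉_; _⊆_; _⊂_; _∩_; _∪_; ∣_∣; Nonempty; ⁅_⁆; ∁; ⊤)
open import Data.Fin.Subset.Properties using (_∈?_; _⊆?_; _⊂?_; nonempty?; anySubset?)
open import Data.Vec using (Vec; []; _∷_; tabulate)
open import Data.List using (List; length)
open import Data.List.Relation.Unary.Linked using (Linked)
open import Data.List.Relation.Unary.Unique.Propositional using (Unique)
open import Data.Product using (Σ; ∃; ∃-syntax; _×_; _,_; proj₁; proj₂)
open import Data.Sum using (_⊎_)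
open import Relation.Nullary using (¬_; Dec; yes; no; _×-dec_; _⊎-dec_; _→-dec_; ¬?)
open import Relation.Nullary.Decidable using (⌊_⌋; map′)
open import Relation.Binary.PropositionalEquality using (_≡_; refl)
open import Function.Bundles using (_↔_; _⇔_; Inverse)

record Graph (n : ℕ) : Set where
  field
    adj     : Fin n → Fin n → Bool
    symm    : ∀ u v → adj u v ≡ adj v u
    irrefl  : ∀ u → adj u u ≡ false

open Graph public

Adj : ∀ {n} → Graph n → Fin n → Fin n → Set
Adj G u v = adj G u v ≡ true

N : ∀ {n} → Graph n → Fin n → Subset n
N G u = tabulate (adj G u)

degree : ∀ {n} → Graph n → Fin n → ℕ
degree G u = ∣ N G u ∣

IsLeaf : ∀ {n} → Graph n → Fin n → Set
IsLeaf G u = degree G u ≡ 1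

-- Induced subgraph G[S] is represented by the pair (G , S), S : Subset n.

data Reach {n} (G : Graph n) (S : Subset n) : Fin n → Fin n → Set where
  here : ∀ {u} → Reach G S u u
  step : ∀ {u w v} → Adj G u w → w ∈ S → Reach G S w v → Reach G S u v

Connected : ∀ {n} → Graph n → Subset n → Set
Connected G S = ∀ u v → u ∈ S → v ∈ S → Reach G S u v

record Cycle {n} (G : Graph n) : Set where
  field
    first  : Fin n
    rest   : List (Fin n)
    last   : Fin n
    long   : 1 ≤ length rest
    distinct : Unique (first Data.List.∷ (rest Data.List.++ (last Data.List.∷ Data.List.[])))
    walk   : Linked (Adj G) (first Data.List.∷ (rest Data.List.++ (last Data.List.∷ Data.List.[])))
    closes : Adj G last first

Acyclic : ∀ {n} → Graph n → Set
Acyclic G = ¬ Cycle G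

IsTree : ∀ {n} → Graph n → Set
IsTree G = Connected G ⊤ × Acyclic G

IsPathGraph : ∀ {n} → Graph n → Set
IsPathGraph {n} G =
  Σ (Fin n ↔ Fin n) λ σ → ∀ i j →
    Adj G (Inverse.to σ i) (Inverse.to σ j) ⇔ (toℕ i ≡ suc (toℕ j) ⊎ toℕ j ≡ suc (toℕ i))

Deg12 : ∀ {n} → Graph n → Subset n → Set
Deg12 G P = ∀ u → u ∈ P → degree G u ≡ 1 ⊎ degree G u ≡ 2

IsPathBranch : ∀ {n} → Graph n → Fin n → Subset n → Set
IsPathBranch G ℓ P =
  ℓ ∈ P × Connected G P × Deg12 G P ×
  (∀ Q → P ⊆ Q → ℓ ∈ Q → Connected G Q → Deg12 G Q → Q ⊆ P)

AdjToSet : ∀ {n} → Graph n → Fin n → Subset n → Set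
AdjToSet G v P = ∃[ u ] (u ∈ P × Adj G v u)

IsNeighborOf : ∀ {n} → Graph n → Subset n → Fin n → Set
IsNeighborOf G P v =
  v ∉ P × AdjToSet G v P × (∀ w → w ∉ P → AdjToSet G w P → w ≡ v)

nbrsIn : ∀ {n} → Graph n → Subset n → Subset n → Fin n → ℕ
nbrsIn G S F u = ∣ F ∩ (S ∩ N G u) ∣

IsFort : ∀ {n} → Graph n → Subset n → Subset n → Set
IsFort G S F =
  Nonempty F × F ⊆ S ×
  (∀ u → u ∈ S → u ∉ F → nbrsIn G S F u ≡ 0 ⊎ 2 ≤ nbrsIn G S F u)

IsMinimalFort : ∀ {n} → Graph n → Subset n → Subset n → Set
IsMinimalFort G S F = IsFort G S F × (∀ F′ → F′ ⊂ F → ¬ IsFort G S F′)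

DisjointFrom : ∀ {n} → Subset n → Subset n → Set
DisjointFrom F A = ∀ x → x ∈ F → x ∉ A

private
  ≡0⊎≥2? : ∀ k → Dec (k ≡ 0 ⊎ 2 ≤ k)
  ≡0⊎≥2? k = (k ℕ.≟ 0) ⊎-dec (2 ≤? k)

isFort? : ∀ {n} (G : Graph n) S F → Dec (IsFort G S F)
isFort? G S F = nonempty? F ×-dec (F ⊆? S) ×-dec
  all? (λ u → (u ∈? S) →-dec (¬? (u ∈? F) →-dec ≡0⊎≥2? (nbrsIn G S F u)))

isMinimalFort? : ∀ {n} (G : Graph n) S F → Dec (IsMinimalFort G S F)
isMinimalFort? G S F = isFort? G S F ×-dec
  map′ (λ ¬∃ F′ F′⊂F fort → ¬∃ (F′ , F′⊂F , fort))
       (λ ∀¬ (F′ , F′⊂F , fort) → ∀¬ F′ F′⊂F fort)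
       (¬? (anySubset? (λ F′ → (F′ ⊂? F) ×-dec isFort? G S F′)))

disjointFrom? : ∀ {n} (F A : Subset n) → Dec (DisjointFrom F A)
disjointFrom? F A = all? (λ x → (x ∈? F) →-dec ¬? (x ∈? A))

countSubsets : ∀ {n} {P : Subset n → Set} → (∀ F → Dec (P F)) → ℕ
countSubsets {zero}  P? with P? []
... | yes _ = 1
... | no  _ = 0
countSubsets {suc n} P? =
  countSubsets (λ F → P? (inside ∷ F)) + countSubsets (λ F → P? (outside ∷ F))

numMinFortsAvoiding : ∀ {n} → Graph n → Subset n → Subset n → ℕ
numMinFortsAvoiding G S A =
  countSubsets (λ F → isMinimalFort? G S F ×-dec disjointFrom? F A)

numMinFortsContainingAvoiding : ∀ {n} → Graph n → Fin n → Subset n → ℕ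
numMinFortsContainingAvoiding G ℓ X =
  countSubsets (λ F → isMinimalFort? G ⊤ F ×-dec (ℓ ∈? F) ×-dec disjointFrom? F X)

{-# OPTIONS --safe #-}
module Submission where

open import Defs
open import Data.Nat using (ℕ; zero; suc; _+_; _≤_; _<_; z≤n; s≤s)
open import Data.Nat.Properties using (≤-refl; ≤-trans; ≤-pred; <-irrefl; +-commutativeSemigroup)
open import Algebra.Properties.CommutativeSemigroup +-commutativeSemigroup using (interchange)
open import Data.Fin using (Fin)
open import Data.Fin.Subset using (Subset; inside; outside; Empty; _∈_; _∉_; _⊆_; _∩_; _∪_; ⁅_⁆; ∁; ⊤; ∣_∣)
open import Data.Fin.Subset.Properties
  using ( _∈?_; ∈⊤; x∈p∩q⁺; x∈p∩q⁻; x∈p∪q⁺; x∈p∪q⁻; x∈⁅x⁆; x∈⁅y⁆⇒x≡y; ∣⁅x⁆∣≡1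
        ; x∈∁p⇒x∉p; x∉p⇒x∈∁p; x∉∁p⇒x∈p; p⊆q⇒∣p∣≤∣q∣; p⊂q⇒∣p∣<∣q∣; p∩q⊆p; p∩q⊆q
        ; ⊆-antisym; ∩-assoc; ∩-identityˡ; Empty-unique; ∣⊥∣≡0 )
open import Data.Vec using ([]; _∷_)
open import Data.Vec.Properties using (lookup∘tabulate; []=⇒lookup; lookup⇒[]=)
open import Data.Product using (_×_; _,_; proj₁; proj₂)
open import Data.Sum using (_⊎_; inj₁; inj₂)
open import Relation.Nullary using (¬_; Dec; yes; no; _×-dec_; ¬?; contradiction)
open import Relation.Binary.PropositionalEquality
  using (_≡_; refl; sym; trans; cong; cong₂; subst; module ≡-Reasoning)

-- Let F be a fort of T missing the leaf ℓ. Then ℓ has at most one, hence (F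
-- being a fort) no, neighbour in F. Walking along the path branch, each vertex
-- has degree at most two and a predecessor outside F, so again it has no
-- neighbour in F; thus F misses P and v. Conversely, if F ⊆ V(T) ∖ P and v ∉ F,
-- no vertex of P sees F, so F is a fort of T exactly when it is a fort of
-- T − P; as the same holds for the subsets of F, minimality transfers as well.
-- Splitting the minimal forts of T avoiding X by whether they contain ℓ gives
-- the identity.

countSubsets-cong : ∀ {n} {P Q : Subset n → Set} (P? : ∀ F → Dec (P F)) (Q? : ∀ F → Dec (Q F)) →
                    (∀ {F} → P F → Q F) → (∀ {F} → Q F → P F) →
                    countSubsets P? ≡ countSubsets Q?
countSubsets-cong {zero} P? Q? P⇒Q Q⇒P with P? [] | Q? []
... | yes _ | yes _ = refl
... | no  _ | no  _ = refl
... | yes p | no ¬q = contradiction (P⇒Q p) ¬q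
... | no ¬p | yes q = contradiction (Q⇒P q) ¬p
countSubsets-cong {suc n} P? Q? P⇒Q Q⇒P = cong₂ _+_
  (countSubsets-cong (λ F → P? (inside ∷ F)) (λ F → Q? (inside ∷ F)) P⇒Q Q⇒P)
  (countSubsets-cong (λ F → P? (outside ∷ F)) (λ F → Q? (outside ∷ F)) P⇒Q Q⇒P)

countSubsets-split : ∀ {n} {P Q : Subset n → Set} (P? : ∀ F → Dec (P F)) (Q? : ∀ F → Dec (Q F)) →
                     countSubsets P?
                       ≡ countSubsets (λ F → P? F ×-dec Q? F) + countSubsets (λ F → P? F ×-dec ¬? (Q? F))
countSubsets-split {zero} P? Q? with P? [] | Q? []
... | yes _ | yes _ = refl
... | yes _ | no  _ = refl
... | no  _ | yes _ = refl
... | no  _ | no  _ = refl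
countSubsets-split {suc n} P? Q? = trans
  (cong₂ _+_ (countSubsets-split (λ F → P? (inside ∷ F)) (λ F → Q? (inside ∷ F)))
             (countSubsets-split (λ F → P? (outside ∷ F)) (λ F → Q? (outside ∷ F))))
  (interchange (count (inside ∷_) Q?) (count (inside ∷_) (λ F → ¬? (Q? F))) _ _)
  where
  count : ∀ {R : Subset (suc n) → Set} → (Subset n → Subset (suc n)) → (∀ F → Dec (R F)) → ℕ
  count s R? = countSubsets (λ F → P? (s F) ×-dec R? (s F))

module _ {n} (G : Graph n) where

  adj⇒∈N : ∀ {u w} → Adj G u w → w ∈ N G u
  adj⇒∈N {u} {w} uw = lookup⇒[]= w (N G u) (trans (lookup∘tabulate (adj G u) w) uw)

  ∈N⇒adj : ∀ {u w} → w ∈ N G u → Adj G u w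
  ∈N⇒adj {u} {w} w∈N = trans (sym (lookup∘tabulate (adj G u) w)) ([]=⇒lookup w∈N)

  adj-sym : ∀ {u w} → Adj G u w → Adj G w u
  adj-sym {u} {w} uw = trans (symm G w u) uw

  module _ {S F : Subset n} {u : Fin n} where

    nbrsIn≡0 : (∀ {w} → w ∈ F → w ∈ S → ¬ Adj G u w) → nbrsIn G S F u ≡ 0
    nbrsIn≡0 none = trans (cong ∣_∣ (Empty-unique empty)) (∣⊥∣≡0 n)
      where
      empty : Empty (F ∩ (S ∩ N G u))
      empty (w , w∈) = let (w∈F , w∈S∩N) = x∈p∩q⁻ F _ w∈
                           (w∈S , w∈N)   = x∈p∩q⁻ S _ w∈S∩N
                       in none w∈F w∈S (∈N⇒adj w∈N)

    1≤nbrsIn : ∀ {w} → w ∈ F → w ∈ S → Adj G u w → 1 ≤ nbrsIn G S F u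
    1≤nbrsIn {w} w∈F w∈S uw = subst (_≤ nbrsIn G S F u) (∣⁅x⁆∣≡1 w) (p⊆q⇒∣p∣≤∣q∣ ⁅w⁆⊆)
      where
      ⁅w⁆⊆ : ⁅ w ⁆ ⊆ F ∩ (S ∩ N G u)
      ⁅w⁆⊆ x∈ rewrite x∈⁅y⁆⇒x≡y w x∈ = x∈p∩q⁺ (w∈F , x∈p∩q⁺ (w∈S , adj⇒∈N uw))

    nbrsIn≤degree : nbrsIn G S F u ≤ degree G u
    nbrsIn≤degree = p⊆q⇒∣p∣≤∣q∣ (λ w∈ → p∩q⊆q S _ (p∩q⊆q F _ w∈))

    nbrsIn<degree : ∀ {x} → Adj G u x → x ∉ F → nbrsIn G S F u < degree G u
    nbrsIn<degree {x} ux x∉F = p⊂q⇒∣p∣<∣q∣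
      ( (λ w∈ → p∩q⊆q S _ (p∩q⊆q F _ w∈))
      , x , adj⇒∈N ux , λ x∈ → x∉F (p∩q⊆p F _ x∈) )

    nbrsIn-⊤ : F ⊆ S → nbrsIn G S F u ≡ nbrsIn G ⊤ F u
    nbrsIn-⊤ F⊆S = cong ∣_∣ (begin
      F ∩ (S ∩ N G u)   ≡⟨ ∩-assoc F S _ ⟨
      (F ∩ S) ∩ N G u   ≡⟨ cong (_∩ N G u) F∩S≡F ⟩
      F ∩ N G u         ≡⟨ cong (F ∩_) (∩-identityˡ _) ⟨
      F ∩ (⊤ ∩ N G u)   ∎)
      where
      open ≡-Reasoning
      F∩S≡F : F ∩ S ≡ F
      F∩S≡F = ⊆-antisym (p∩q⊆p F S) (λ x∈F → x∈p∩q⁺ (x∈F , F⊆S x∈F))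

ClosedNbhdDisjoint : ∀ {n} → Graph n → Subset n → Fin n → Set
ClosedNbhdDisjoint G F x = x ∉ F × (∀ w → Adj G x w → w ∉ F)

module FortPropagation {n} (G : Graph n) {F : Subset n} (fort : IsFort G ⊤ F) where

  fewNbrs⇒closedNbhdDisjoint : ∀ {u} → u ∉ F → nbrsIn G ⊤ F u ≤ 1 → ClosedNbhdDisjoint G F u
  fewNbrs⇒closedNbhdDisjoint {u} u∉F few = u∉F , noNbr
    where
    noNbr : ∀ w → Adj G u w → w ∉ F
    noNbr w uw w∈F with proj₂ (proj₂ fort) u ∈⊤ u∉F
    ... | inj₁ none = contradiction (subst (1 ≤_) none (1≤nbrsIn G w∈F ∈⊤ uw)) λ ()
    ... | inj₂ two  = <-irrefl refl (≤-trans two few)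

  leaf⇒closedNbhdDisjoint : ∀ {ℓ} → IsLeaf G ℓ → ℓ ∉ F → ClosedNbhdDisjoint G F ℓ
  leaf⇒closedNbhdDisjoint {ℓ} leaf ℓ∉F =
    fewNbrs⇒closedNbhdDisjoint ℓ∉F (subst (nbrsIn G ⊤ F ℓ ≤_) leaf (nbrsIn≤degree G {⊤} {F}))

  closedNbhdDisjoint-step : ∀ {u w} → ClosedNbhdDisjoint G F u → Adj G u w → degree G w ≤ 2 →
                            ClosedNbhdDisjoint G F w
  closedNbhdDisjoint-step {u} {w} (u∉F , nbrs∉F) uw deg≤2 =
    fewNbrs⇒closedNbhdDisjoint w∉F (≤-pred (≤-trans (nbrsIn<degree G {⊤} (adj-sym G uw) u∉F) deg≤2))
    where
    w∉F : w ∉ F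
    w∉F = nbrs∉F w uw

  closedNbhdDisjoint-reach : ∀ {P u x} → Deg12 G P → ClosedNbhdDisjoint G F u → Reach G P u x →
                             ClosedNbhdDisjoint G F x
  closedNbhdDisjoint-reach d12 disj here = disj
  closedNbhdDisjoint-reach d12 disj (step {w = w} uw w∈P reach) =
    closedNbhdDisjoint-reach d12 (closedNbhdDisjoint-step disj uw deg≤2) reach
    where
    deg≤2 : degree G w ≤ 2
    deg≤2 with d12 w w∈P
    ... | inj₁ deg≡1 = subst (_≤ 2) (sym deg≡1) (s≤s z≤n)
    ... | inj₂ deg≡2 = subst (_≤ 2) (sym deg≡2) ≤-refl

module _ {n} (G : Graph n) {S F : Subset n} where

  fort-restrict : F ⊆ S → IsFort G ⊤ F → IsFort G S F
  fort-restrict F⊆S (ne , _ , out) = ne , F⊆S , λ u _ u∉F →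
    subst (λ k → k ≡ 0 ⊎ 2 ≤ k) (sym (nbrsIn-⊤ G F⊆S)) (out u ∈⊤ u∉F)

  fort-extend : (∀ u → u ∉ S → nbrsIn G ⊤ F u ≡ 0) → IsFort G S F → IsFort G ⊤ F
  fort-extend unseen (ne , F⊆S , out) = ne , (λ _ → ∈⊤) , out⊤
    where
    out⊤ : ∀ u → u ∈ ⊤ → u ∉ F → nbrsIn G ⊤ F u ≡ 0 ⊎ 2 ≤ nbrsIn G ⊤ F u
    out⊤ u _ u∉F with u ∈? S
    ... | yes u∈S = subst (λ k → k ≡ 0 ⊎ 2 ≤ k) (nbrsIn-⊤ G F⊆S) (out u u∈S u∉F)
    ... | no  u∉S = inj₁ (unseen u u∉S)

module _ {n} {F A : Subset n} {v : Fin n} where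

  disjointFrom-∪⁅⁆⁺ : DisjointFrom F A → v ∉ F → DisjointFrom F (A ∪ ⁅ v ⁆)
  disjointFrom-∪⁅⁆⁺ F∩A≡∅ v∉F x x∈F x∈A∪v with x∈p∪q⁻ A ⁅ v ⁆ x∈A∪v
  ... | inj₁ x∈A = F∩A≡∅ x x∈F x∈A
  ... | inj₂ x∈v = v∉F (subst (_∈ F) (x∈⁅y⁆⇒x≡y v x∈v) x∈F)

  disjointFrom-∪⁅⁆⁻ : DisjointFrom F (A ∪ ⁅ v ⁆) → DisjointFrom F A × v ∉ F
  disjointFrom-∪⁅⁆⁻ disj = (λ x x∈F x∈A → disj x x∈F (x∈p∪q⁺ (inj₁ x∈A)))
                          , (λ v∈F → disj v v∈F (x∈p∪q⁺ (inj₂ (x∈⁅x⁆ v))))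

module PathBranch {n} (T : Graph n) {ℓ v : Fin n} {P : Subset n}
  (leaf : IsLeaf T ℓ) (ℓ∈P : ℓ ∈ P) (conn : Connected T P) (d12 : Deg12 T P)
  (v-adj : AdjToSet T v P) (v-unique : ∀ w → w ∉ P → AdjToSet T w P → w ≡ v) where

  fort-missing-leaf : ∀ {F} → IsFort T ⊤ F → ℓ ∉ F → F ⊆ ∁ P × v ∉ F
  fort-missing-leaf {F} fort ℓ∉F = (λ x∈F → x∉p⇒x∈∁p λ x∈P → proj₁ (along x∈P) x∈F) , v∉F
    where
    open FortPropagation T fort
    along : ∀ {x} → x ∈ P → ClosedNbhdDisjoint T F x
    along x∈P = closedNbhdDisjoint-reach d12 (leaf⇒closedNbhdDisjoint leaf ℓ∉F) (conn ℓ _ ℓ∈P x∈P)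
    v∉F : v ∉ F
    v∉F = let (u , u∈P , vu) = v-adj in proj₂ (along u∈P) v (adj-sym T vu)

  branch-unseen : ∀ {F} → F ⊆ ∁ P → v ∉ F → ∀ u → u ∉ ∁ P → nbrsIn T ⊤ F u ≡ 0
  branch-unseen {F} F⊆∁P v∉F u u∉∁P = nbrsIn≡0 T λ {w} w∈F _ uw →
    v∉F (subst (_∈ F) (v-unique w (x∈∁p⇒x∉p (F⊆∁P w∈F)) (u , x∉∁p⇒x∈p u∉∁P , adj-sym T uw)) w∈F)

  minimalFort-restrict : ∀ {F} → IsMinimalFort T ⊤ F → ℓ ∉ F → IsMinimalFort T (∁ P) F × v ∉ F
  minimalFort-restrict {F} (fort , minimal) ℓ∉F =
    ( fort-restrict T F⊆∁P fort
    , λ F′ F′⊂F fort′ → minimal F′ F′⊂F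
        (fort-extend T (branch-unseen (λ m → F⊆∁P (proj₁ F′⊂F m)) (λ m → v∉F (proj₁ F′⊂F m))) fort′) )
    , v∉F
    where
    F⊆∁P : F ⊆ ∁ P
    F⊆∁P = proj₁ (fort-missing-leaf fort ℓ∉F)
    v∉F : v ∉ F
    v∉F = proj₂ (fort-missing-leaf fort ℓ∉F)

  minimalFort-extend : ∀ {F} → IsMinimalFort T (∁ P) F → v ∉ F → IsMinimalFort T ⊤ F × ℓ ∉ F
  minimalFort-extend (fort@(_ , F⊆∁P , _) , minimal) v∉F =
    ( fort-extend T (branch-unseen F⊆∁P v∉F) fort
    , λ F′ F′⊂F fort′ → minimal F′ F′⊂F (fort-restrict T (λ m → F⊆∁P (proj₁ F′⊂F m)) fort′) )
    , λ ℓ∈F → x∈∁p⇒x∉p (F⊆∁P ℓ∈F) ℓ∈P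

  minimalFortAvoiding-restrict : ∀ {F X} → (IsMinimalFort T ⊤ F × DisjointFrom F X) × ℓ ∉ F →
                                 IsMinimalFort T (∁ P) F × DisjointFrom F (X ∪ ⁅ v ⁆)
  minimalFortAvoiding-restrict ((min , disj) , ℓ∉F) =
    let (min′ , v∉F) = minimalFort-restrict min ℓ∉F in min′ , disjointFrom-∪⁅⁆⁺ disj v∉F

  minimalFortAvoiding-extend : ∀ {F X} → IsMinimalFort T (∁ P) F × DisjointFrom F (X ∪ ⁅ v ⁆) →
                               (IsMinimalFort T ⊤ F × DisjointFrom F X) × ℓ ∉ F
  minimalFortAvoiding-extend (min , disj) =
    let (disjX , v∉F)  = disjointFrom-∪⁅⁆⁻ disj
        (min′ , ℓ∉F) = minimalFort-extend min v∉F
    in (min′ , disjX) , ℓ∉F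

-- T being a tree that is not a path only ensures that P and v exist.
lemma19 : ∀ {n} (T : Graph n) → IsTree T → ¬ IsPathGraph T →
          (ℓ : Fin n) → IsLeaf T ℓ →
          (P : Subset n) → IsPathBranch T ℓ P →
          (v : Fin n) → IsNeighborOf T P v →
          (X : Subset n) → ℓ ∉ X →
          numMinFortsAvoiding T ⊤ X
            ≡ numMinFortsContainingAvoiding T ℓ X
              + numMinFortsAvoiding T (∁ P) (X ∪ ⁅ v ⁆)
lemma19 T _ _ ℓ leaf P (ℓ∈P , conn , d12 , _) v (_ , v-adj , v-unique) X _ = begin
    numMinFortsAvoiding T ⊤ X
  ≡⟨ countSubsets-split avoidsX? (ℓ ∈?_) ⟩
    countSubsets (λ F → avoidsX? F ×-dec ℓ ∈? F) + countSubsets (λ F → avoidsX? F ×-dec ¬? (ℓ ∈? F))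
  ≡⟨ cong₂ _+_
       (countSubsets-cong (λ F → avoidsX? F ×-dec ℓ ∈? F) _
          (λ ((min , disj) , ℓ∈F) → min , ℓ∈F , disj) (λ (min , ℓ∈F , disj) → (min , disj) , ℓ∈F))
       (countSubsets-cong (λ F → avoidsX? F ×-dec ¬? (ℓ ∈? F)) _
          minimalFortAvoiding-restrict minimalFortAvoiding-extend) ⟩
    numMinFortsContainingAvoiding T ℓ X + numMinFortsAvoiding T (∁ P) (X ∪ ⁅ v ⁆)
  ∎
  where
  open ≡-Reasoning
  open PathBranch T leaf ℓ∈P conn d12 v-adj v-unique

  avoidsX? : ∀ F → Dec (IsMinimalFort T ⊤ F × DisjointFrom F X)
  avoidsX? F = isMinimalFort? T ⊤ F ×-dec disjointFrom? F X
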